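{- If $s$ is a linear-changing pattern substitution, then there exist a pattern substitution $s'$ and a linear-changing identity substitution $t$ such that $s=s'\circ t$.
   Context: Calculus (λ-calculus with linear, affine and intuitionistic variables, in canonical form). Variables are de Bruijn indices $n\ge1$ with a flag $f\in\{\mathsf I,\mathsf A,\mathsf L\}$ (intuitionistic, affine, linear), written $n^f$. Substitutions $s::=\mathsf{id}\mid{\uparrow}\mid M^f.s\mid s\circ t$, ${\uparrow}^n$ the $n$-fold composition of ${\uparrow}$; equalities: $1^f[M^f.s]=M$, $(n+1)^f=1^f[{\uparrow}^n]$, $M[s][t]=M[s\circ t]$, ${\uparrow}\circ(M^f.s)=s$, $(M^f.s)\circ t=M[t]^f.(s\circ t)$, $\mathsf{id}\circ s=s\circ\mathsf{id}=s$, $(s_1\circ s_2)\circ s_3=s_1\circ(s_2\circ s_3)$, ${\uparrow}^n=(n+1)^{ff}.{\uparrow}^{n+1}$. Contexts are lists of assumptions $A^l$ with $l\in\{\mathsf I,\mathsf A,\mathsf L,\mathsf{UA},\mathsf{UL}\}$, and $\Gamma\vdash s:\Gamma'$ is the typing of substitutions in the linear/affine calculus. An extension $M^f$ whose term is a variable $m^{f'}$ is written $m^{f'f}$; it is linear if $f'f=\mathsf{LL}$, affine if $\mathsf{AA}$, intuitionistic if $\mathsf{II}$, and linear-changing if $f'f\in\{\mathsf{IL},\mathsf{IA},\mathsf{AL}\}$. A pattern substitution is a substitution $a_1^{f_1}\ldots a_p^{f_p}.{\uparrow}^n$ (well typed, $\Gamma\vdash s:\Gamma'$ with $n$ the length of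 $\Gamma$) in which all $a_j$ are distinct de Bruijn indices (variables) and no extension is linear-changing. A linear-changing pattern substitution is the same except that linear-changing extensions are permitted. A linear-changing identity substitution is one of the form $1^{f_1f'_1}.2^{f_2f'_2}\ldots n^{f_nf'_n}.{\uparrow}^n$, i.e. η-equivalent to $\mathsf{id}$ except for some number of linear-changing extensions. -}

module Defs where

open import Data.Nat using (ℕ; zero; suc)
open import Data.List using (List; []; _∷_; length; map)
open import Data.List.Relation.Unary.All using (All)
open import Data.List.Relation.Unary.Unique.Propositional using (Unique)
open import Data.Product using (Σ; _×_; _,_; proj₁)
open import Data.Sum using (_⊎_)
open import Relation.Binary.PropositionalEquality using (_≡_; _≢_)
open import Relation.Nullary using (¬_)

data Flag : Set where
  I A L : Flag

data AFlag : Set where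
  aI aA aL aUA aUL : AFlag

lvl : Flag → AFlag
lvl I = aI
lvl A = aA
lvl L = aL

data LinChanging : Flag → Flag → Set where
  IL : LinChanging I L
  IA : LinChanging I A
  AL : LinChanging A L

-- Types (only needed as labels of assumptions)

data Ty : Set where
  atom : ℕ → Ty
  _⇒_  : Ty → Ty → Ty
  _⊸ᵃ_ : Ty → Ty → Ty
  _⊸_  : Ty → Ty → Ty

-- contexts; the head of the list is the assumption for de Bruijn index 1
Ctx : Set
Ctx = List (Ty × AFlag)

-- Terms and substitutions (the variable / explicit-substitution fragment)

infixl 8 _[_]
infixr 6 _^_·_
infixr 7 _∘_

data Tm : Set
data Sub : Set

data Tm where
  var  : ℕ → Flag → Tm      -- var n f  is  n^f  (de Bruijn index n ≥ 1)
  _[_] : Tm → Sub → Tm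

data Sub where
  id    : Sub
  ↑     : Sub
  _^_·_ : Tm → Flag → Sub → Sub
  _∘_   : Sub → Sub → Sub

↑^ : ℕ → Sub
↑^ zero    = id
↑^ (suc n) = ↑ ∘ ↑^ n

infix 4 _≈ₜ_ _≈ₛ_

data _≈ₜ_ : Tm → Tm → Set
data _≈ₛ_ : Sub → Sub → Set

data _≈ₜ_ where
  reflₜ  : ∀ {M} → M ≈ₜ M
  symₜ   : ∀ {M N} → M ≈ₜ N → N ≈ₜ M
  transₜ : ∀ {M N P} → M ≈ₜ N → N ≈ₜ P → M ≈ₜ P
  cong[] : ∀ {M N s t} → M ≈ₜ N → s ≈ₛ t → M [ s ] ≈ₜ N [ t ]
  beta1  : ∀ {f M s} → var 1 f [ M ^ f · s ] ≈ₜ M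
  varsuc : ∀ {n f} → var (suc n) f ≈ₜ var 1 f [ ↑^ n ]
  clos   : ∀ {M s t} → M [ s ] [ t ] ≈ₜ M [ s ∘ t ]

data _≈ₛ_ where
  reflₛ  : ∀ {s} → s ≈ₛ s
  symₛ   : ∀ {s t} → s ≈ₛ t → t ≈ₛ s
  transₛ : ∀ {s t u} → s ≈ₛ t → t ≈ₛ u → s ≈ₛ u
  cong·  : ∀ {M N f s t} → M ≈ₜ N → s ≈ₛ t → M ^ f · s ≈ₛ N ^ f · t
  cong∘  : ∀ {s s' t t'} → s ≈ₛ s' → t ≈ₛ t' → s ∘ t ≈ₛ s' ∘ t'
  shiftExt : ∀ {M f s} → ↑ ∘ (M ^ f · s) ≈ₛ s
  extComp  : ∀ {M f s t} → (M ^ f · s) ∘ t ≈ₛ M [ t ] ^ f · (s ∘ t)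
  idL      : ∀ {s} → id ∘ s ≈ₛ s
  idR      : ∀ {s} → s ∘ id ≈ₛ s
  assoc    : ∀ {s₁ s₂ s₃} → (s₁ ∘ s₂) ∘ s₃ ≈ₛ s₁ ∘ (s₂ ∘ s₃)
  eta      : ∀ {n f} → ↑^ n ≈ₛ var (suc n) f ^ f · ↑^ (suc n)

Droppable : AFlag → Set
Droppable l = l ≢ aL

bar : Ctx → Ctx
bar [] = []
bar ((B , aA) ∷ Γ) = (B , aUA) ∷ bar Γ
bar ((B , aL) ∷ Γ) = (B , aUL) ∷ bar Γ
bar ((B , l)  ∷ Γ) = (B , l) ∷ bar Γ

data _≔_⋈_ : Ctx → Ctx → Ctx → Set where
  []⋈   : [] ≔ [] ⋈ []
  I⋈    : ∀ {Γ Γ₁ Γ₂ B} → Γ ≔ Γ₁ ⋈ Γ₂ → ((B , aI) ∷ Γ) ≔ ((B , aI) ∷ Γ₁) ⋈ ((B , aI) ∷ Γ₂)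
  UA⋈   : ∀ {Γ Γ₁ Γ₂ B} → Γ ≔ Γ₁ ⋈ Γ₂ → ((B , aUA) ∷ Γ) ≔ ((B , aUA) ∷ Γ₁) ⋈ ((B , aUA) ∷ Γ₂)
  UL⋈   : ∀ {Γ Γ₁ Γ₂ B} → Γ ≔ Γ₁ ⋈ Γ₂ → ((B , aUL) ∷ Γ) ≔ ((B , aUL) ∷ Γ₁) ⋈ ((B , aUL) ∷ Γ₂)
  Al⋈   : ∀ {Γ Γ₁ Γ₂ B} → Γ ≔ Γ₁ ⋈ Γ₂ → ((B , aA) ∷ Γ) ≔ ((B , aA) ∷ Γ₁) ⋈ ((B , aUA) ∷ Γ₂)
  Ar⋈   : ∀ {Γ Γ₁ Γ₂ B} → Γ ≔ Γ₁ ⋈ Γ₂ → ((B , aA) ∷ Γ) ≔ ((B , aUA) ∷ Γ₁) ⋈ ((B , aA) ∷ Γ₂)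
  Ll⋈   : ∀ {Γ Γ₁ Γ₂ B} → Γ ≔ Γ₁ ⋈ Γ₂ → ((B , aL) ∷ Γ) ≔ ((B , aL) ∷ Γ₁) ⋈ ((B , aUL) ∷ Γ₂)
  Lr⋈   : ∀ {Γ Γ₁ Γ₂ B} → Γ ≔ Γ₁ ⋈ Γ₂ → ((B , aL) ∷ Γ) ≔ ((B , aUL) ∷ Γ₁) ⋈ ((B , aL) ∷ Γ₂)

data _∋_∶_ : Ctx → ℕ → Ty → Set where
  here  : ∀ {Γ B l} → ((B , l) ∷ Γ) ∋ 1 ∶ B
  there : ∀ {Γ n B C l} → Γ ∋ n ∶ B → ((C , l) ∷ Γ) ∋ suc n ∶ B

infix 3 _⊢_∶_ _⊢ᵘ_∶_ _⊢ₛ_∶_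

data _⊢_∶_  : Ctx → Tm → Ty → Set
data _⊢ᵘ_∶_ : Ctx → Tm → Ty → Set
data _⊢ₛ_∶_ : Ctx → Sub → Ctx → Set

data _⊢_∶_ where
  top : ∀ {Γ B f} → All (λ a → Droppable (Data.Product.proj₂ a)) Γ →
        ((B , lvl f) ∷ Γ) ⊢ var 1 f ∶ B
  pop : ∀ {Γ n f B C l} → Droppable l → Γ ⊢ var n f ∶ B →
        ((C , l) ∷ Γ) ⊢ var (suc n) f ∶ B
  clo : ∀ {Γ Γ' s M B} → Γ ⊢ₛ s ∶ Γ' → Γ' ⊢ M ∶ B → Γ ⊢ M [ s ] ∶ B

-- typing of terms placed at unavailable positions (resources not checked)
data _⊢ᵘ_∶_ where
  uvar : ∀ {Γ n f B} → Γ ∋ n ∶ B → Γ ⊢ᵘ var n f ∶ B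
  uclo : ∀ {Γ Γ' s M B} → Γ ⊢ₛ s ∶ Γ' → Γ' ⊢ᵘ M ∶ B → Γ ⊢ᵘ M [ s ] ∶ B

data _⊢ₛ_∶_ where
  tid   : ∀ {Γ} → Γ ⊢ₛ id ∶ Γ
  tshift : ∀ {Γ B l} → Droppable l → ((B , l) ∷ Γ) ⊢ₛ ↑ ∶ Γ
  tcomp : ∀ {Γ₁ Γ₂ Γ₃ s t} → Γ₁ ⊢ₛ t ∶ Γ₂ → Γ₂ ⊢ₛ s ∶ Γ₃ → Γ₁ ⊢ₛ s ∘ t ∶ Γ₃
  textI : ∀ {Γ Γ' s M B} → Γ ⊢ₛ s ∶ Γ' → bar Γ ⊢ M ∶ B →
          Γ ⊢ₛ M ^ I · s ∶ ((B , aI) ∷ Γ')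
  textL : ∀ {Γ Γ₁ Γ₂ Γ' s M B} → Γ ≔ Γ₁ ⋈ Γ₂ → Γ₁ ⊢ₛ s ∶ Γ' → Γ₂ ⊢ M ∶ B →
          Γ ⊢ₛ M ^ L · s ∶ ((B , aL) ∷ Γ')
  textA : ∀ {Γ Γ₁ Γ₂ Γ' s M B} → Γ ≔ Γ₁ ⋈ Γ₂ → Γ₁ ⊢ₛ s ∶ Γ' →
          All (λ a → Droppable (Data.Product.proj₂ a)) Γ₂ → Γ₂ ⊢ M ∶ B →
          Γ ⊢ₛ M ^ A · s ∶ ((B , aA) ∷ Γ')
  textUA : ∀ {Γ Γ' s M B} → Γ ⊢ₛ s ∶ Γ' → Γ ⊢ᵘ M ∶ B →
           Γ ⊢ₛ M ^ A · s ∶ ((B , aUA) ∷ Γ')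
  textUL : ∀ {Γ Γ' s M B} → Γ ⊢ₛ s ∶ Γ' → Γ ⊢ᵘ M ∶ B →
           Γ ⊢ₛ M ^ L · s ∶ ((B , aUL) ∷ Γ')

-- an extension a^{f'f}: variable index a, variable flag f', extension flag f
record Entry : Set where
  constructor ent
  field
    idx   : ℕ
    vflag : Flag
    eflag : Flag
open Entry public

build : List Entry → ℕ → Sub
build []       n = ↑^ n
build (e ∷ es) n = var (idx e) (vflag e) ^ eflag e · build es n

IsLCPatternSub : Ctx → Sub → Ctx → Set
IsLCPatternSub Γ s Γ' =
  Σ (List Entry) λ es →
    (s ≡ build es (length Γ)) × Unique (map idx es) × (Γ ⊢ₛ s ∶ Γ')

IsPatternSub : Ctx → Sub → Ctx → Set
IsPatternSub Γ s Γ' =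
  Σ (List Entry) λ es →
    (s ≡ build es (length Γ)) × Unique (map idx es) ×
    All (λ e → ¬ LinChanging (vflag e) (eflag e)) es × (Γ ⊢ₛ s ∶ Γ')

idEntries : List (Flag × Flag) → ℕ → List Entry
idEntries []              k = []
idEntries ((f' , f) ∷ fs) k = ent k f' f ∷ idEntries fs (suc k)

IsLCIdSub : Sub → Set
IsLCIdSub t =
  Σ (List (Flag × Flag)) λ fs →
    (t ≡ build (idEntries fs 1) (length fs)) ×
    All (λ p → (proj₁ p ≡ Data.Product.proj₂ p) ⊎ LinChanging (proj₁ p) (Data.Product.proj₂ p)) fs

-- Write s = a₁^{f'₁f₁} … a_p^{f'_pf_p}.↑ⁿ. Typing forces the entries into available
-- assumptions to read variables whose flag in Γ is f'_j with f'_j ≼ f_j (f'_j = f_j or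
-- f'_jf_j linear-changing), and every linear assumption of Γ to be read by such an entry.
-- So position by position: where such an entry reads position k, let t be k^{f'_jf_j} and
-- let s' read k with flag f_j; at every other position let t pass an unavailable linear
-- assumption on (flag L), read by s' with flag L. Then s' has no linear-changing entry,
-- s ≈ s' ∘ t holds entry by entry, and both factors are typed by checking the same
-- resource condition, which is equivalent to typing for substitutions of distinct variables.

module Submission where

open import Defs
open import Data.Empty using (⊥; ⊥-elim)
open import Data.List using (List; []; _∷_; _++_; length; map)
open import Data.List.Properties using (∷-injective; length-map; ++-assoc; length-++)
open import Data.List.Relation.Binary.Pointwise as Pointwise using (Pointwise; []; _∷_)
open import Data.List.Relation.Unary.All as All using (All; []; _∷_)
open import Data.List.Relation.Unary.All.Properties using (++⁺)
open import Data.List.Relation.Unary.AllPairs using ([]; _∷_)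
open import Data.List.Relation.Unary.Unique.Propositional using (Unique)
open import Data.Nat using (ℕ; zero; suc; _+_; _≤_)
open import Data.Nat.Properties using (_≟_; suc-injective; ≤-refl; <⇒≤; <⇒≢; +-suc; +-comm)
open import Data.Product using (Σ; ∃; ∃₂; _×_; _,_; proj₁; proj₂; map₂)
open import Data.Sum as Sum using (_⊎_; inj₁; inj₂)
open import Level using (0ℓ)
open import Relation.Binary.Bundles using (Setoid)
open import Relation.Binary.PropositionalEquality using (_≡_; _≢_; refl; sym; trans; cong; subst)
import Relation.Binary.Reasoning.Setoid as SetoidReasoning
open import Relation.Nullary using (¬_; yes; no)

_≼_ : Flag → Flag → Set
f' ≼ f = (f' ≡ f) ⊎ LinChanging f' f

≼-refl : ∀ {f} → f ≼ f
≼-refl = inj₁ refl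

≼-L : ∀ f → f ≼ L
≼-L I = inj₂ IL
≼-L A = inj₂ AL
≼-L L = ≼-refl

≼-A : ∀ f → Droppable (lvl f) → f ≼ A
≼-A I _ = inj₂ IA
≼-A A _ = ≼-refl
≼-A L d = ⊥-elim (d refl)

≼-A⁻ : ∀ {f} → f ≼ A → Droppable (lvl f)
≼-A⁻ {I} _ ()
≼-A⁻ {A} _ ()
≼-A⁻ {L} (inj₁ ())
≼-A⁻ {L} (inj₂ ())

¬LC-refl : ∀ {f} → ¬ LinChanging f f
¬LC-refl ()

¬LC-L : ∀ {f} → ¬ LinChanging L f
¬LC-L ()

data Available : AFlag → Set where
  aI : Available aI
  aA : Available aA
  aL : Available aL

lvl-available : ∀ f → Available (lvl f)
lvl-available I = aI
lvl-available A = aA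
lvl-available L = aL

bar₁ : AFlag → AFlag
bar₁ aA = aUA
bar₁ aL = aUL
bar₁ l  = l

bar₁-droppable : ∀ l → Droppable (bar₁ l)
bar₁-droppable aI  ()
bar₁-droppable aA  ()
bar₁-droppable aL  ()
bar₁-droppable aUA ()
bar₁-droppable aUL ()

bar₁-available⁻ : ∀ l → Available (bar₁ l) → l ≡ aI
bar₁-available⁻ aI _ = refl
bar₁-available⁻ aA ()
bar₁-available⁻ aL ()
bar₁-available⁻ aUA ()
bar₁-available⁻ aUL ()

lvl-aI⁻ : ∀ f → lvl f ≡ aI → f ≡ I
lvl-aI⁻ I _ = refl
lvl-aI⁻ A ()
lvl-aI⁻ L ()

bar-map : ∀ Δ → bar Δ ≡ map (map₂ bar₁) Δ
bar-map [] = refl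
bar-map ((B , aI)  ∷ Δ) = cong (_ ∷_) (bar-map Δ)
bar-map ((B , aA)  ∷ Δ) = cong (_ ∷_) (bar-map Δ)
bar-map ((B , aL)  ∷ Δ) = cong (_ ∷_) (bar-map Δ)
bar-map ((B , aUA) ∷ Δ) = cong (_ ∷_) (bar-map Δ)
bar-map ((B , aUL) ∷ Δ) = cong (_ ∷_) (bar-map Δ)

Droppables : Ctx → Set
Droppables = All (λ x → Droppable (proj₂ x))

tys : Ctx → List Ty
tys = map proj₁

length-tys : ∀ {Γ Δ} → tys Γ ≡ tys Δ → length Γ ≡ length Δ
length-tys {Γ} {Δ} eq = trans (sym (length-map proj₁ Γ)) (trans (cong length eq) (length-map proj₁ Δ))

∋-tys : ∀ {Γ Δ a B} → tys Γ ≡ tys Δ → Γ ∋ a ∶ B → Δ ∋ a ∶ B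
∋-tys {Δ = []} () here
∋-tys {Δ = _ ∷ _} eq here with ∷-injective eq
... | refl , _ = here
∋-tys {Δ = []} () (there _)
∋-tys {Δ = _ ∷ _} eq (there ni) = there (∋-tys (proj₂ (∷-injective eq)) ni)

infix 4 _∋_↦_

-- Indices start at 1; `there` only produces indices ≥ 2, so no index-0 case ever arises.

data _∋_↦_ : Ctx → ℕ → Ty × AFlag → Set where
  here  : ∀ {Δ x} → (x ∷ Δ) ∋ 1 ↦ x
  there : ∀ {Δ a x y} → Δ ∋ suc a ↦ x → (y ∷ Δ) ∋ suc (suc a) ↦ x

↦-suc : ∀ {Δ a x y} → Δ ∋ a ↦ x → (y ∷ Δ) ∋ suc a ↦ x
↦-suc here      = there here
↦-suc (there p) = there (there p)

↦⇒∋ : ∀ {Δ a B l} → Δ ∋ a ↦ (B , l) → Δ ∋ a ∶ B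
↦⇒∋ here      = here
↦⇒∋ (there p) = there (↦⇒∋ p)

↦-functional : ∀ {Δ a x y} → Δ ∋ a ↦ x → Δ ∋ a ↦ y → x ≡ y
↦-functional here      here      = refl
↦-functional (there p) (there q) = ↦-functional p q

Droppables-∋ : ∀ {Δ a B l} → Droppables Δ → Δ ∋ a ↦ (B , l) → Droppable l
Droppables-∋ (d ∷ _)  here      = d
Droppables-∋ (_ ∷ ds) (there p) = Droppables-∋ ds p

nonlinear⇒Droppables : ∀ {Δ} → (∀ {k B} → ¬ Δ ∋ k ↦ (B , aL)) → Droppables Δ
nonlinear⇒Droppables {[]} _ = []
nonlinear⇒Droppables {(B , l) ∷ Δ} nonlinear =
  (λ { refl → nonlinear here }) ∷ nonlinear⇒Droppables (λ p → nonlinear (↦-suc p))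

infix 4 _≔_⋈₁_

data _≔_⋈₁_ : AFlag → AFlag → AFlag → Set where
  I  : aI  ≔ aI  ⋈₁ aI
  UA : aUA ≔ aUA ⋈₁ aUA
  UL : aUL ≔ aUL ⋈₁ aUL
  Aˡ : aA  ≔ aA  ⋈₁ aUA
  Aʳ : aA  ≔ aUA ⋈₁ aA
  Lˡ : aL  ≔ aL  ⋈₁ aUL
  Lʳ : aL  ≔ aUL ⋈₁ aL

data Split : Ctx → Ctx → Ctx → Set where
  []  : Split [] [] []
  _∷_ : ∀ {B l l₁ l₂ Δ Δ₁ Δ₂} → l ≔ l₁ ⋈₁ l₂ → Split Δ Δ₁ Δ₂ →
        Split ((B , l) ∷ Δ) ((B , l₁) ∷ Δ₁) ((B , l₂) ∷ Δ₂)

⋈⇒Split : ∀ {Δ Δ₁ Δ₂} → Δ ≔ Δ₁ ⋈ Δ₂ → Split Δ Δ₁ Δ₂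
⋈⇒Split []⋈     = []
⋈⇒Split (I⋈ sp)  = I  ∷ ⋈⇒Split sp
⋈⇒Split (UA⋈ sp) = UA ∷ ⋈⇒Split sp
⋈⇒Split (UL⋈ sp) = UL ∷ ⋈⇒Split sp
⋈⇒Split (Al⋈ sp) = Aˡ ∷ ⋈⇒Split sp
⋈⇒Split (Ar⋈ sp) = Aʳ ∷ ⋈⇒Split sp
⋈⇒Split (Ll⋈ sp) = Lˡ ∷ ⋈⇒Split sp
⋈⇒Split (Lr⋈ sp) = Lʳ ∷ ⋈⇒Split sp

⋈₁-availableˡ : ∀ {l l₁ l₂} → l ≔ l₁ ⋈₁ l₂ → Available l₁ → l ≡ l₁
⋈₁-availableˡ I  aI = refl
⋈₁-availableˡ Aˡ aA = refl
⋈₁-availableˡ Lˡ aL = refl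

⋈₁-availableʳ : ∀ {l l₁ l₂} → l ≔ l₁ ⋈₁ l₂ → Available l₂ → l ≡ l₂
⋈₁-availableʳ I  aI = refl
⋈₁-availableʳ Aʳ aA = refl
⋈₁-availableʳ Lʳ aL = refl

⋈₁-linear : ∀ {l₁ l₂} → aL ≔ l₁ ⋈₁ l₂ → l₁ ≡ aL ⊎ l₂ ≡ aL
⋈₁-linear Lˡ = inj₁ refl
⋈₁-linear Lʳ = inj₂ refl

Split-tysˡ : ∀ {Δ Δ₁ Δ₂} → Split Δ Δ₁ Δ₂ → tys Δ₁ ≡ tys Δ
Split-tysˡ []      = refl
Split-tysˡ (_ ∷ S) = cong (_ ∷_) (Split-tysˡ S)

Split-∋ˡ : ∀ {Δ Δ₁ Δ₂ k B l} → Split Δ Δ₁ Δ₂ → Available l → Δ₁ ∋ k ↦ (B , l) → Δ ∋ k ↦ (B , l)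
Split-∋ˡ (s ∷ _) av here with ⋈₁-availableˡ s av
... | refl = here
Split-∋ˡ (_ ∷ S) av (there p) = there (Split-∋ˡ S av p)

Split-∋ʳ : ∀ {Δ Δ₁ Δ₂ k B l} → Split Δ Δ₁ Δ₂ → Available l → Δ₂ ∋ k ↦ (B , l) → Δ ∋ k ↦ (B , l)
Split-∋ʳ (s ∷ _) av here with ⋈₁-availableʳ s av
... | refl = here
Split-∋ʳ (_ ∷ S) av (there p) = there (Split-∋ʳ S av p)

Split-linear : ∀ {Δ Δ₁ Δ₂ k B} → Split Δ Δ₁ Δ₂ → Δ ∋ k ↦ (B , aL) →
               Δ₁ ∋ k ↦ (B , aL) ⊎ Δ₂ ∋ k ↦ (B , aL)
Split-linear (s ∷ _) here with ⋈₁-linear s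
... | inj₁ refl = inj₁ here
... | inj₂ refl = inj₂ here
Split-linear (_ ∷ S) (there p) = Sum.map there there (Split-linear S p)

length-⋈ˡ : ∀ {Δ Δ₁ Δ₂} → Δ ≔ Δ₁ ⋈ Δ₂ → length Δ₁ ≡ length Δ
length-⋈ˡ sp = length-tys (Split-tysˡ (⋈⇒Split sp))

⋈-keepˡ : ∀ {Γ Γ₁ Γ₂} B l → Γ ≔ Γ₁ ⋈ Γ₂ → ((B , l) ∷ Γ) ≔ ((B , l) ∷ Γ₁) ⋈ ((B , bar₁ l) ∷ Γ₂)
⋈-keepˡ B aI  = I⋈
⋈-keepˡ B aA  = Al⋈
⋈-keepˡ B aL  = Ll⋈
⋈-keepˡ B aUA = UA⋈
⋈-keepˡ B aUL = UL⋈

⋈-keepʳ : ∀ {Γ Γ₁ Γ₂} B l → Γ ≔ Γ₁ ⋈ Γ₂ → ((B , l) ∷ Γ) ≔ ((B , bar₁ l) ∷ Γ₁) ⋈ ((B , l) ∷ Γ₂)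
⋈-keepʳ B aI  = I⋈
⋈-keepʳ B aA  = Ar⋈
⋈-keepʳ B aL  = Lr⋈
⋈-keepʳ B aUA = UA⋈
⋈-keepʳ B aUL = UL⋈

⋈-bar : ∀ Δ → Δ ≔ Δ ⋈ map (map₂ bar₁) Δ
⋈-bar []            = []⋈
⋈-bar ((B , l) ∷ Δ) = ⋈-keepˡ B l (⋈-bar Δ)

bar-Droppables : ∀ Δ → Droppables (map (map₂ bar₁) Δ)
bar-Droppables []            = []
bar-Droppables ((_ , l) ∷ Δ) = bar₁-droppable l ∷ bar-Droppables Δ

consume : ∀ {Δ a x} → Δ ∋ a ↦ x → Ctx
consume {(B , l) ∷ Δ} here = (B , bar₁ l) ∷ Δ
consume {y ∷ Δ} (there p)  = y ∷ consume p

isolate : ∀ {Δ a x} → Δ ∋ a ↦ x → Ctx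
isolate {x ∷ Δ} here             = x ∷ map (map₂ bar₁) Δ
isolate {(B , l) ∷ Δ} (there p)  = (B , bar₁ l) ∷ isolate p

consume-⋈ : ∀ {Δ a x} (p : Δ ∋ a ↦ x) → Δ ≔ consume p ⋈ isolate p
consume-⋈ {(B , l) ∷ Δ} here      = ⋈-keepʳ B l (⋈-bar Δ)
consume-⋈ {(B , l) ∷ Δ} (there p) = ⋈-keepˡ B l (consume-⋈ p)

consume-tys : ∀ {Δ a x} (p : Δ ∋ a ↦ x) → tys (consume p) ≡ tys Δ
consume-tys here      = refl
consume-tys (there p) = cong (_ ∷_) (consume-tys p)

consume-∋ : ∀ {Δ a k x y} (p : Δ ∋ a ↦ x) → a ≢ k → Δ ∋ k ↦ y → consume p ∋ k ↦ y
consume-∋ here      a≢k here      = ⊥-elim (a≢k refl)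
consume-∋ here      _   (there q) = there q
consume-∋ (there p) _   here      = here
consume-∋ (there p) a≢k (there q) = there (consume-∋ p (λ e → a≢k (cong suc e)) q)

consume-∋⁻ : ∀ {Δ a k x B l} (p : Δ ∋ a ↦ x) → consume p ∋ k ↦ (B , l) →
             (a ≡ k × Droppable l) ⊎ (a ≢ k × Δ ∋ k ↦ (B , l))
consume-∋⁻ {(_ , l) ∷ _} here here = inj₁ (refl , bar₁-droppable l)
consume-∋⁻ here      (there q) = inj₂ ((λ ()) , there q)
consume-∋⁻ (there p) here      = inj₂ ((λ ()) , here)
consume-∋⁻ (there p) (there q) =
  Sum.map (λ (a≡k , d) → cong suc a≡k , d) (λ (a≢k , q') → (λ { refl → a≢k refl }) , there q')
          (consume-∋⁻ p q)

isolate-⊢ : ∀ {Δ a B f} (p : Δ ∋ a ↦ (B , lvl f)) → isolate p ⊢ var a f ∶ B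
isolate-⊢ {_ ∷ Δ} here              = top (bar-Droppables Δ)
isolate-⊢ {(_ , l) ∷ _} (there p)   = pop (bar₁-droppable l) (isolate-⊢ p)

isolate-Droppables : ∀ {Δ a B l} (p : Δ ∋ a ↦ (B , l)) → Droppable l → Droppables (isolate p)
isolate-Droppables {_ ∷ Δ} here d             = d ∷ bar-Droppables Δ
isolate-Droppables {(_ , l) ∷ _} (there p) d  = bar₁-droppable l ∷ isolate-Droppables p d

isolate-aI : ∀ {Δ a B} (p : Δ ∋ a ↦ (B , aI)) → isolate p ≡ map (map₂ bar₁) Δ
isolate-aI here      = refl
isolate-aI (there p) = cong (_ ∷_) (isolate-aI p)

var-⊢⁻ : ∀ {Δ a f B} → Δ ⊢ var a f ∶ B →
         Δ ∋ a ↦ (B , lvl f) × (∀ {k C l} → Δ ∋ k ↦ (C , l) → k ≢ a → Droppable l)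
var-⊢⁻ {Δ} (top ds) = here , others
  where
  others : ∀ {k C l} → Δ ∋ k ↦ (C , l) → k ≢ 1 → Droppable l
  others here      k≢1 = ⊥-elim (k≢1 refl)
  others (there q) _   = Droppables-∋ ds q
var-⊢⁻ {Δ} {a} (pop d v) with var-⊢⁻ v
... | p , others = ↦-suc p , others'
  where
  others' : ∀ {k C l} → Δ ∋ k ↦ (C , l) → k ≢ a → Droppable l
  others' here      _   = d
  others' (there q) k≢a = others q (λ e → k≢a (cong suc e))

map-bar-∋⁻ : ∀ {Δ a B l'} → map (map₂ bar₁) Δ ∋ a ↦ (B , l') → ∃ λ l → Δ ∋ a ↦ (B , l) × l' ≡ bar₁ l
map-bar-∋⁻ {(_ , l) ∷ _} here = l , here , refl
map-bar-∋⁻ {_ ∷ _} (there q) with map-bar-∋⁻ q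
... | l , p , e = l , there p , e

bar-var-⊢⁻ : ∀ {Δ a f B} → bar Δ ⊢ var a f ∶ B → f ≡ I × Δ ∋ a ↦ (B , aI)
bar-var-⊢⁻ {Δ} {f = f} v with map-bar-∋⁻ (proj₁ (var-⊢⁻ (subst (_⊢ _ ∶ _) (bar-map Δ) v)))
... | l , p , lvl≡bar with bar₁-available⁻ l (subst Available lvl≡bar (lvl-available f))
... | refl = lvl-aI⁻ f lvl≡bar , p

⊢-↑^-suc : ∀ k {Δ Δ₁ Γ} → Δ ⊢ₛ ↑ ∶ Δ₁ → Δ₁ ⊢ₛ ↑^ k ∶ Γ → Δ ⊢ₛ ↑^ (suc k) ∶ Γ
⊢-↑^-suc zero    d tid             = tcomp tid d
⊢-↑^-suc (suc k) d (tcomp d₁ d₂) = tcomp (⊢-↑^-suc k d d₁) d₂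

Droppables⇒⊢-↑^ : ∀ {Δ} → Droppables Δ → Δ ⊢ₛ ↑^ (length Δ) ∶ []
Droppables⇒⊢-↑^ []       = tid
Droppables⇒⊢-↑^ (d ∷ ds) = ⊢-↑^-suc _ (tshift d) (Droppables⇒⊢-↑^ ds)

⊢-↑^⁻ : ∀ n {Δ Γ} → Δ ⊢ₛ ↑^ n ∶ Γ →
        Σ Ctx λ Π → Δ ≡ Π ++ Γ × length Π ≡ n × Droppables Π
⊢-↑^⁻ zero tid = [] , refl , refl , []
⊢-↑^⁻ (suc n) (tcomp d (tshift {B = B} {l = l} dl)) with ⊢-↑^⁻ n d
... | Π , refl , refl , ds =
  Π ++ ((B , l) ∷ []) , sym (++-assoc Π _ _) , trans (length-++ Π) (+-comm _ 1) , ++⁺ ds (dl ∷ [])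

-- Typing of substitutions made of distinct variables

infix 4 _⊩ₑ_∶_ _⊩_∶_

data _⊩ₑ_∶_ (Δ : Ctx) : Entry → Ty × AFlag → Set where
  into-available : ∀ {a f' f B} → Δ ∋ a ↦ (B , lvl f') → f' ≼ f → Δ ⊩ₑ ent a f' f ∶ (B , lvl f)
  into-UA        : ∀ {a f' B} → Δ ∋ a ∶ B → Δ ⊩ₑ ent a f' A ∶ (B , aUA)
  into-UL        : ∀ {a f' B} → Δ ∋ a ∶ B → Δ ⊩ₑ ent a f' L ∶ (B , aUL)

data Consumes : List Entry → Ctx → ℕ → Set where
  here  : ∀ {e es B m Γ'} → Available m → Consumes (e ∷ es) ((B , m) ∷ Γ') (idx e)
  there : ∀ {e es x Γ' k} → Consumes es Γ' k → Consumes (e ∷ es) (x ∷ Γ') k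

-- The resource condition of `_⊢ₛ_∶_` on a substitution of distinct variables
-- (equivalent to typing by `⊢⇒⊩` and `⊩⇒⊢`).
record _⊩_∶_ (Δ : Ctx) (es : List Entry) (Γ' : Ctx) : Set where
  constructor resourced
  field
    distinct    : Unique (map idx es)
    extensions  : Pointwise (Δ ⊩ₑ_∶_) es Γ'
    linear-used : ∀ {k B} → Δ ∋ k ↦ (B , aL) → Consumes es Γ' k
open _⊩_∶_

⊩ₑ-∋ : ∀ {Δ e B m} → Δ ⊩ₑ e ∶ (B , m) → Δ ∋ idx e ∶ B
⊩ₑ-∋ (into-available p _) = ↦⇒∋ p
⊩ₑ-∋ (into-UA ni)         = ni
⊩ₑ-∋ (into-UL ni)         = ni

Consumes-∷⁻ : ∀ {e es B m Γ' k} → Consumes (e ∷ es) ((B , m) ∷ Γ') k →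
              (k ≡ idx e × Available m) ⊎ Consumes es Γ' k
Consumes-∷⁻ (here av) = inj₁ (refl , av)
Consumes-∷⁻ (there c) = inj₂ c

⊩-tail : ∀ {Δ e es B m Γ'} → Δ ⊩ e ∷ es ∶ (B , m) ∷ Γ' →
         (∀ {C} → Δ ∋ idx e ↦ (C , aL) → Available m → ⊥) → Δ ⊩ es ∶ Γ'
⊩-tail {Δ} {e} {es} {B} {m} {Γ'} (resourced (_ ∷ distinct) (_ ∷ exts) linear-used) head-unused =
  resourced distinct exts (λ q → tail-used q (Consumes-∷⁻ (linear-used q)))
  where
  tail-used : ∀ {k C} → Δ ∋ k ↦ (C , aL) → (k ≡ idx e × Available m) ⊎ Consumes es Γ' k → Consumes es Γ' k
  tail-used q (inj₁ (refl , av)) = ⊥-elim (head-unused q av)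
  tail-used _ (inj₂ c)           = c

⊩-∷ : ∀ {Δ e es x Γ'} → All (idx e ≢_) (map idx es) → Δ ⊩ₑ e ∶ x → Δ ⊩ es ∶ Γ' → Δ ⊩ e ∷ es ∶ x ∷ Γ'
⊩-∷ e∉ ext (resourced distinct exts linear-used) =
  resourced (e∉ ∷ distinct) (ext ∷ exts) (λ q → there (linear-used q))

⊩ₑ-Splitˡ : ∀ {Δ Δ₁ Δ₂ e x} → Split Δ Δ₁ Δ₂ → Δ₁ ⊩ₑ e ∶ x → Δ ⊩ₑ e ∶ x
⊩ₑ-Splitˡ S (into-available {f' = f'} p f'≼f) = into-available (Split-∋ˡ S (lvl-available f') p) f'≼f
⊩ₑ-Splitˡ S (into-UA ni) = into-UA (∋-tys (Split-tysˡ S) ni)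
⊩ₑ-Splitˡ S (into-UL ni) = into-UL (∋-tys (Split-tysˡ S) ni)

⊩-⋈ : ∀ {Δ Δ₁ Δ₂ a f' f B es Γ'} → Δ ≔ Δ₁ ⋈ Δ₂ → All (a ≢_) (map idx es) →
      Δ₁ ⊩ es ∶ Γ' → Δ₂ ⊢ var a f' ∶ B → f' ≼ f → Δ ⊩ ent a f' f ∷ es ∶ (B , lvl f) ∷ Γ'
⊩-⋈ {Δ} {a = a} {f' = f'} {f} {B} {es} {Γ'} sp a∉ (resourced distinct exts linear-used) v f'≼f
  with ⋈⇒Split sp | var-⊢⁻ v
... | S | p , others =
  resourced (a∉ ∷ distinct)
            (into-available (Split-∋ʳ S (lvl-available f') p) f'≼f ∷ Pointwise.map (⊩ₑ-Splitˡ S) exts)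
            linear-used'
  where
  linear-used' : ∀ {k C} → Δ ∋ k ↦ (C , aL) → Consumes (ent a f' f ∷ es) ((B , lvl f) ∷ Γ') k
  linear-used' {k} q with Split-linear S q | k ≟ a
  ... | inj₁ q₁ | _        = there (linear-used q₁)
  ... | inj₂ _  | yes refl = here (lvl-available f)
  ... | inj₂ q₂ | no k≢a   = ⊥-elim (others q₂ k≢a refl)

⊩ₑ-consume : ∀ {Δ a x e y} (p : Δ ∋ a ↦ x) → a ≢ idx e → Δ ⊩ₑ e ∶ y → consume p ⊩ₑ e ∶ y
⊩ₑ-consume p a≢e (into-available q f'≼f) = into-available (consume-∋ p a≢e q) f'≼f
⊩ₑ-consume p _   (into-UA ni)            = into-UA (∋-tys (sym (consume-tys p)) ni)
⊩ₑ-consume p _   (into-UL ni)            = into-UL (∋-tys (sym (consume-tys p)) ni)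

⊩-consume : ∀ {Δ e es y Γ' x} (p : Δ ∋ idx e ↦ x) → Δ ⊩ e ∷ es ∶ y ∷ Γ' → consume p ⊩ es ∶ Γ'
⊩-consume {Δ} {e} {es} {y} {Γ'} p (resourced (e∉ ∷ distinct) (_ ∷ exts) linear-used) =
  resourced distinct (consume-extensions e∉ exts) linear-used'
  where
  consume-extensions : ∀ {es Γ'} → All (idx e ≢_) (map idx es) → Pointwise (Δ ⊩ₑ_∶_) es Γ' →
                       Pointwise (consume p ⊩ₑ_∶_) es Γ'
  consume-extensions [] [] = []
  consume-extensions (ne ∷ nes) (ext ∷ exts) = ⊩ₑ-consume p ne ext ∷ consume-extensions nes exts

  linear-used' : ∀ {k C} → consume p ∋ k ↦ (C , aL) → Consumes es Γ' k
  linear-used' q with consume-∋⁻ p q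
  ... | inj₁ (_ , d) = ⊥-elim (d refl)
  ... | inj₂ (e≢k , q') with linear-used q'
  ...   | here _  = ⊥-elim (e≢k refl)
  ...   | there c = c

⊩⇒⊢ : ∀ {Δ es Γ' n} → length Δ ≡ n → Δ ⊩ es ∶ Γ' → Δ ⊢ₛ build es n ∶ Γ'
⊩⇒⊢ {es = []} refl (resourced _ [] linear-used) =
  Droppables⇒⊢-↑^ (nonlinear⇒Droppables (λ q → nothing-consumed (linear-used q)))
  where
  nothing-consumed : ∀ {k} → ¬ Consumes [] [] k
  nothing-consumed ()
⊩⇒⊢ {Δ} len ⊩@(resourced _ (into-available {a} {f = I} {B} p (inj₁ refl) ∷ _) _) =
  textI (⊩⇒⊢ len (⊩-tail ⊩ not-linear)) bar-⊢
  where
  not-linear : ∀ {C} → Δ ∋ a ↦ (C , aL) → Available aI → ⊥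
  not-linear q _ with ↦-functional q p
  ... | ()
  bar-⊢ : bar Δ ⊢ var a I ∶ B
  bar-⊢ = subst (_⊢ var a I ∶ B) (trans (isolate-aI p) (sym (bar-map Δ))) (isolate-⊢ p)
⊩⇒⊢ len (resourced _ (into-available {f = I} _ (inj₂ ()) ∷ _) _)
⊩⇒⊢ len ⊩@(resourced _ (into-available {f = A} p f'≼A ∷ _) _) =
  textA (consume-⋈ p) (⊩⇒⊢ (trans (length-tys (consume-tys p)) len) (⊩-consume p ⊩))
        (isolate-Droppables p (≼-A⁻ f'≼A)) (isolate-⊢ p)
⊩⇒⊢ len ⊩@(resourced _ (into-available {f = L} p _ ∷ _) _) =
  textL (consume-⋈ p) (⊩⇒⊢ (trans (length-tys (consume-tys p)) len) (⊩-consume p ⊩)) (isolate-⊢ p)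
⊩⇒⊢ len ⊩@(resourced _ (into-UA ni ∷ _) _) = textUA (⊩⇒⊢ len (⊩-tail ⊩ λ _ ())) (uvar ni)
⊩⇒⊢ len ⊩@(resourced _ (into-UL ni ∷ _) _) = textUL (⊩⇒⊢ len (⊩-tail ⊩ λ _ ())) (uvar ni)

++-length⁻ : ∀ (Π : Ctx) {Γ} → length (Π ++ Γ) ≡ length Π → Γ ≡ []
++-length⁻ [] {[]} _ = refl
++-length⁻ (_ ∷ Π) eq = ++-length⁻ Π (suc-injective eq)

⊢⇒⊩ : ∀ {Δ es Γ' n} → length Δ ≡ n → Unique (map idx es) → Δ ⊢ₛ build es n ∶ Γ' → Δ ⊩ es ∶ Γ'
⊢⇒⊩ {es = []} len [] d with ⊢-↑^⁻ _ d
... | Π , refl , refl , ds with ++-length⁻ Π len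
... | refl = resourced [] [] (λ q → ⊥-elim (Droppables-∋ (++⁺ ds []) q refl))
⊢⇒⊩ {es = ent a f' I ∷ es} len (a∉ ∷ distinct) (textI d v) with bar-var-⊢⁻ v
... | refl , p = ⊩-∷ a∉ (into-available p ≼-refl) (⊢⇒⊩ len distinct d)
⊢⇒⊩ {es = ent a f' L ∷ es} len (a∉ ∷ distinct) (textL sp d v) =
  ⊩-⋈ sp a∉ (⊢⇒⊩ (trans (length-⋈ˡ sp) len) distinct d) v (≼-L f')
⊢⇒⊩ {es = ent a f' A ∷ es} len (a∉ ∷ distinct) (textA sp d ds v) =
  ⊩-⋈ sp a∉ (⊢⇒⊩ (trans (length-⋈ˡ sp) len) distinct d) v (≼-A f' (Droppables-∋ ds (proj₁ (var-⊢⁻ v))))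
⊢⇒⊩ {es = ent a f' A ∷ es} len (a∉ ∷ distinct) (textUA d (uvar ni)) = ⊩-∷ a∉ (into-UA ni) (⊢⇒⊩ len distinct d)
⊢⇒⊩ {es = ent a f' L ∷ es} len (a∉ ∷ distinct) (textUL d (uvar ni)) = ⊩-∷ a∉ (into-UL ni) (⊢⇒⊩ len distinct d)

-- The factorisation

-- How a position of the source context is read: by an entry into an available
-- assumption (consumed) or into an unavailable one (mentioned).
data Use : Set where
  unused    : Use
  mentioned : Flag → Use
  consumed  : Flag → Flag → Use

useOf : Entry → AFlag → Use
useOf e aI  = consumed (vflag e) (eflag e)
useOf e aA  = consumed (vflag e) (eflag e)
useOf e aL  = consumed (vflag e) (eflag e)
useOf e aUA = mentioned (vflag e)
useOf e aUL = mentioned (vflag e)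

useAt : List Entry → Ctx → ℕ → Use
useAt []       _  _ = unused
useAt (_ ∷ _)  [] _ = unused
useAt (e ∷ es) ((_ , m) ∷ Γ') k with idx e ≟ k
... | yes _ = useOf e m
... | no  _ = useAt es Γ' k

Tracks : (ℕ → Use) → List Entry → Ctx → Set
Tracks u = Pointwise (λ e x → u (idx e) ≡ useOf e (proj₂ x))

useOf-lvl : ∀ e f → useOf e (lvl f) ≡ consumed (vflag e) (eflag e)
useOf-lvl e I = refl
useOf-lvl e A = refl
useOf-lvl e L = refl

useAt-hit : ∀ {e es B m Γ'} → useAt (e ∷ es) ((B , m) ∷ Γ') (idx e) ≡ useOf e m
useAt-hit {e} with idx e ≟ idx e
... | yes _  = refl
... | no ne = ⊥-elim (ne refl)

useAt-miss : ∀ {e es x Γ' k} → idx e ≢ k → useAt (e ∷ es) (x ∷ Γ') k ≡ useAt es Γ' k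
useAt-miss {e} {k = k} e≢k with idx e ≟ k
... | yes e≡k = ⊥-elim (e≢k e≡k)
... | no  _   = refl

useAt-tracks : ∀ {R : Entry → Ty × AFlag → Set} {es Γ'} → Unique (map idx es) → Pointwise R es Γ' →
               Tracks (useAt es Γ') es Γ'
useAt-tracks [] [] = []
useAt-tracks {es = e ∷ es} {x ∷ Γ'} (e∉ ∷ distinct) (_ ∷ rs) =
  useAt-hit {es = es} {proj₁ x} {proj₂ x} {Γ'} ∷ tracks-miss e∉ (useAt-tracks distinct rs)
  where
  tracks-miss : ∀ {es₀ Γ₀} → All (idx e ≢_) (map idx es₀) → Tracks (useAt es Γ') es₀ Γ₀ →
                Tracks (useAt (e ∷ es) (x ∷ Γ')) es₀ Γ₀
  tracks-miss [] [] = []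
  tracks-miss (ne ∷ nes) (t ∷ ts) = trans (useAt-miss {es = es} {x} {Γ'} ne) t ∷ tracks-miss nes ts

Tracks-Consumes : ∀ {u es Γ' k} → Tracks u es Γ' → Consumes es Γ' k → ∃₂ λ f' f → u k ≡ consumed f' f
Tracks-Consumes (t ∷ _) (here aI) = _ , _ , t
Tracks-Consumes (t ∷ _) (here aA) = _ , _ , t
Tracks-Consumes (t ∷ _) (here aL) = _ , _ , t
Tracks-Consumes (_ ∷ ts) (there c) = Tracks-Consumes ts c

⊩ₑ-consumed : ∀ {Δ e B m f' f} → Δ ⊩ₑ e ∶ (B , m) → useOf e m ≡ consumed f' f →
              Available m × Δ ∋ idx e ↦ (B , lvl f') × f' ≼ f
⊩ₑ-consumed (into-available {f' = f'} {f} p f'≼f) eq with trans (sym (useOf-lvl (ent _ f' f) f)) eq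
... | refl = lvl-available f , p , f'≼f

useAt-consumed : ∀ {Δ es Γ' k f' f} → Pointwise (Δ ⊩ₑ_∶_) es Γ' → useAt es Γ' k ≡ consumed f' f →
                 Consumes es Γ' k × ∃ λ B → Δ ∋ k ↦ (B , lvl f') × f' ≼ f
useAt-consumed {es = e ∷ es} {(B , m) ∷ Γ'} {k} (ext ∷ exts) eq with idx e ≟ k
... | yes refl with ⊩ₑ-consumed ext eq
...   | av , p , f'≼f = here av , B , p , f'≼f
useAt-consumed {es = e ∷ es} {(B , m) ∷ Γ'} {k} (ext ∷ exts) eq | no e≢k
  with useAt-consumed exts eq
... | c , rest = there c , rest

Fits₁ : AFlag → Use → Set
Fits₁ l unused         = Droppable l
Fits₁ l (mentioned _)  = Droppable l
Fits₁ l (consumed f' f) = l ≡ lvl f' × f' ≼ f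

Fits : (ℕ → Use) → Ctx → Set
Fits u Δ = ∀ {k B l} → Δ ∋ k ↦ (B , l) → Fits₁ l (u k)

Fits-tail : ∀ {u x Δ} → Fits u (x ∷ Δ) → Fits (λ k → u (suc k)) Δ
Fits-tail fits q = fits (↦-suc q)

⊩-Fits : ∀ {Δ es Γ'} → Δ ⊩ es ∶ Γ' → Fits (useAt es Γ') Δ
⊩-Fits {Δ} {es} {Γ'} (resourced distinct exts linear-used) {k} {B} {l} q = fits (useAt es Γ' k) refl
  where
  droppable : ∀ {w} → useAt es Γ' k ≡ w → (∀ {f' f} → w ≢ consumed f' f) → Droppable l
  droppable eq not-consumed l≡aL
    with Tracks-Consumes (useAt-tracks distinct exts) (linear-used (subst (λ l → Δ ∋ k ↦ (B , l)) l≡aL q))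
  ... | _ , _ , c = not-consumed (trans (sym eq) c)

  fits : ∀ w → useAt es Γ' k ≡ w → Fits₁ l w
  fits unused          eq = droppable eq λ ()
  fits (mentioned _)   eq = droppable eq λ ()
  fits (consumed f' f) eq with useAt-consumed exts eq
  ... | _ , _ , p , f'≼f = cong proj₂ (↦-functional q p) , f'≼f

-- At a position k with use w, the identity factor is k^{srcFlag w, midFlag w} into an
-- assumption of flag midLevel w, and s' reads the entry a = k as a^{midFlag w, f}.
srcFlag : Use → Flag
srcFlag unused          = L
srcFlag (mentioned f')  = f'
srcFlag (consumed f' _) = f'

midFlag : Use → Flag
midFlag unused         = L
midFlag (mentioned _)  = L
midFlag (consumed _ f) = f

midLevel : Use → AFlag
midLevel unused         = aUL
midLevel (mentioned _)  = aUL
midLevel (consumed _ f) = lvl f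

middle : (ℕ → Use) → Ctx → Ctx
middle u []            = []
middle u ((B , _) ∷ Δ) = (B , midLevel (u 1)) ∷ middle (λ k → u (suc k)) Δ

pairs : (ℕ → Use) → Ctx → List (Flag × Flag)
pairs u []      = []
pairs u (_ ∷ Δ) = (srcFlag (u 1) , midFlag (u 1)) ∷ pairs (λ k → u (suc k)) Δ

relabel : List Entry → Ctx → List Entry
relabel []       _  = []
relabel (_ ∷ _)  [] = []
relabel (e ∷ es) ((_ , m) ∷ Γ') = ent (idx e) (midFlag (useOf e m)) (eflag e) ∷ relabel es Γ'

srcFlag-useOf : ∀ e m → srcFlag (useOf e m) ≡ vflag e
srcFlag-useOf e aI  = refl
srcFlag-useOf e aA  = refl
srcFlag-useOf e aL  = refl
srcFlag-useOf e aUA = refl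
srcFlag-useOf e aUL = refl

¬LC-useOf : ∀ e m → ¬ LinChanging (midFlag (useOf e m)) (eflag e)
¬LC-useOf e aI  = ¬LC-refl
¬LC-useOf e aA  = ¬LC-refl
¬LC-useOf e aL  = ¬LC-refl
¬LC-useOf e aUA = ¬LC-L
¬LC-useOf e aUL = ¬LC-L

Fits₁-≼ : ∀ {l} w → Fits₁ l w → srcFlag w ≼ midFlag w
Fits₁-≼ unused          _          = ≼-refl
Fits₁-≼ (mentioned f')  _          = ≼-L f'
Fits₁-≼ (consumed _ _)  (_ , f'≼f) = f'≼f

midLevel-aL⁻ : ∀ w → midLevel w ≡ aL → ∃₂ λ f' f → w ≡ consumed f' f
midLevel-aL⁻ (consumed f' f) _ = f' , f , refl

length-pairs : ∀ u Δ → length (pairs u Δ) ≡ length Δ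
length-pairs u []      = refl
length-pairs u (_ ∷ Δ) = cong suc (length-pairs (λ k → u (suc k)) Δ)

length-idEntries : ∀ fs j → length (idEntries fs j) ≡ length fs
length-idEntries []       j = refl
length-idEntries (_ ∷ fs) j = cong suc (length-idEntries fs (suc j))

middle-tys : ∀ u Δ → tys (middle u Δ) ≡ tys Δ
middle-tys u []      = refl
middle-tys u (_ ∷ Δ) = cong (_ ∷_) (middle-tys (λ k → u (suc k)) Δ)

middle-∋ : ∀ {u Δ k B l} → Δ ∋ k ↦ (B , l) → middle u Δ ∋ k ↦ (B , midLevel (u k))
middle-∋ here      = here
middle-∋ (there q) = there (middle-∋ q)

middle-∋⁻ : ∀ {u Δ k B l} → middle u Δ ∋ k ↦ (B , l) → l ≡ midLevel (u k)
middle-∋⁻ {Δ = _ ∷ _} here      = refl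
middle-∋⁻ {Δ = _ ∷ _} (there q) = middle-∋⁻ q

idEntries-≥ : ∀ fs j → All (j ≤_) (map idx (idEntries fs j))
idEntries-≥ []       j = []
idEntries-≥ (_ ∷ fs) j = ≤-refl ∷ All.map <⇒≤ (idEntries-≥ fs (suc j))

idEntries-distinct : ∀ fs j → Unique (map idx (idEntries fs j))
idEntries-distinct []       j = []
idEntries-distinct (_ ∷ fs) j = All.map <⇒≢ (idEntries-≥ fs (suc j)) ∷ idEntries-distinct fs (suc j)

⊩ₑ-there : ∀ {Δ y k f' f x} → Δ ⊩ₑ ent (suc k) f' f ∶ x → (y ∷ Δ) ⊩ₑ ent (suc (suc k)) f' f ∶ x
⊩ₑ-there (into-available p f'≼f) = into-available (there p) f'≼f
⊩ₑ-there (into-UA ni)            = into-UA (there ni)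
⊩ₑ-there (into-UL ni)            = into-UL (there ni)

idEntries-there : ∀ {Δ y Γ''} fs j → Pointwise (Δ ⊩ₑ_∶_) (idEntries fs (suc j)) Γ'' →
                  Pointwise ((y ∷ Δ) ⊩ₑ_∶_) (idEntries fs (suc (suc j))) Γ''
idEntries-there []       j []           = []
idEntries-there (_ ∷ fs) j (ext ∷ exts) = ⊩ₑ-there ext ∷ idEntries-there fs (suc j) exts

Consumes-there : ∀ {Γ'' k} fs j → Consumes (idEntries fs (suc j)) Γ'' k →
                 Consumes (idEntries fs (suc (suc j))) Γ'' (suc k)
Consumes-there (_ ∷ fs) j (here av) = here av
Consumes-there (_ ∷ fs) j (there c) = there (Consumes-there fs (suc j) c)

⊩ₑ-head : ∀ {Δ B l} w → Fits₁ l w → ((B , l) ∷ Δ) ⊩ₑ ent 1 (srcFlag w) (midFlag w) ∶ (B , midLevel w)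
⊩ₑ-head unused         _             = into-UL here
⊩ₑ-head (mentioned _)  _             = into-UL here
⊩ₑ-head (consumed _ _) (refl , f'≼f) = into-available here f'≼f

Fits₁-linear : ∀ w → Fits₁ aL w → Available (midLevel w)
Fits₁-linear unused         d = ⊥-elim (d refl)
Fits₁-linear (mentioned _)  d = ⊥-elim (d refl)
Fits₁-linear (consumed _ f) _ = lvl-available f

idSub-extensions : ∀ {Δ} u → Fits u Δ → Pointwise (Δ ⊩ₑ_∶_) (idEntries (pairs u Δ) 1) (middle u Δ)
idSub-extensions {[]}    u fits = []
idSub-extensions {_ ∷ Δ} u fits =
  ⊩ₑ-head (u 1) (fits here) ∷ idEntries-there (pairs _ Δ) 0 (idSub-extensions _ (Fits-tail fits))

idSub-linear-used : ∀ {Δ} u → Fits u Δ →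
                    ∀ {k B} → Δ ∋ k ↦ (B , aL) → Consumes (idEntries (pairs u Δ) 1) (middle u Δ) k
idSub-linear-used         u fits here      = here (Fits₁-linear (u 1) (fits here))
idSub-linear-used {_ ∷ Δ} u fits (there q) =
  there (Consumes-there (pairs _ Δ) 0 (idSub-linear-used _ (Fits-tail fits) q))

idSub-⊩ : ∀ {Δ} u → Fits u Δ → Δ ⊩ idEntries (pairs u Δ) 1 ∶ middle u Δ
idSub-⊩ u fits = resourced (idEntries-distinct _ 1) (idSub-extensions u fits) (idSub-linear-used u fits)

pairs-≼ : ∀ {Δ} u → Fits u Δ → All (λ p → proj₁ p ≼ proj₂ p) (pairs u Δ)
pairs-≼ {[]}    u fits = []
pairs-≼ {_ ∷ Δ} u fits = Fits₁-≼ (u 1) (fits here) ∷ pairs-≼ _ (Fits-tail fits)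

relabel-idx : ∀ {R : Entry → Ty × AFlag → Set} {es Γ'} → Pointwise R es Γ' → map idx (relabel es Γ') ≡ map idx es
relabel-idx []       = refl
relabel-idx (_ ∷ rs) = cong (_ ∷_) (relabel-idx rs)

relabel-unchanging : ∀ es Γ' → All (λ e → ¬ LinChanging (vflag e) (eflag e)) (relabel es Γ')
relabel-unchanging []       _  = []
relabel-unchanging (_ ∷ _)  [] = []
relabel-unchanging (e ∷ es) ((_ , m) ∷ Γ') = ¬LC-useOf e m ∷ relabel-unchanging es Γ'

Consumes-relabel : ∀ {es Γ' k} → Consumes es Γ' k → Consumes (relabel es Γ') Γ' k
Consumes-relabel (here av) = here av
Consumes-relabel (there c) = there (Consumes-relabel c)

⊩ₑ-relabel : ∀ {Δ u e B m} → u (idx e) ≡ useOf e m → Δ ⊩ₑ e ∶ (B , m) →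
             middle u Δ ⊩ₑ ent (idx e) (midFlag (useOf e m)) (eflag e) ∶ (B , m)
⊩ₑ-relabel {Δ} {u} {B = B} t (into-available {a} {f'} {f} p _) rewrite useOf-lvl (ent a f' f) f =
  into-available (subst (λ w → middle u Δ ∋ a ↦ (B , midLevel w)) t (middle-∋ p)) ≼-refl
⊩ₑ-relabel {Δ} {u} _ (into-UA ni) = into-UA (∋-tys (sym (middle-tys u Δ)) ni)
⊩ₑ-relabel {Δ} {u} _ (into-UL ni) = into-UL (∋-tys (sym (middle-tys u Δ)) ni)

relabel-⊩ : ∀ {Δ es Γ'} → Δ ⊩ es ∶ Γ' → middle (useAt es Γ') Δ ⊩ relabel es Γ' ∶ Γ'
relabel-⊩ {Δ} {es} {Γ'} (resourced distinct exts linear-used) =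
  resourced (subst Unique (sym (relabel-idx exts)) distinct)
            (relabel-extensions (useAt-tracks distinct exts) exts)
            linear-used'
  where
  u : ℕ → Use
  u = useAt es Γ'

  relabel-extensions : ∀ {es Γ'} → Tracks u es Γ' → Pointwise (Δ ⊩ₑ_∶_) es Γ' →
                       Pointwise (middle u Δ ⊩ₑ_∶_) (relabel es Γ') Γ'
  relabel-extensions []       []           = []
  relabel-extensions (t ∷ ts) (ext ∷ exts) = ⊩ₑ-relabel t ext ∷ relabel-extensions ts exts

  linear-used' : ∀ {k B} → middle u Δ ∋ k ↦ (B , aL) → Consumes (relabel es Γ') Γ' k
  linear-used' {k} q with midLevel-aL⁻ (u k) (sym (middle-∋⁻ q))
  ... | _ , _ , eq = Consumes-relabel (proj₁ (useAt-consumed exts eq))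

≈ₜ-setoid : Setoid 0ℓ 0ℓ
≈ₜ-setoid = record
  { Carrier = Tm ; _≈_ = _≈ₜ_
  ; isEquivalence = record { refl = reflₜ ; sym = symₜ ; trans = transₜ } }

≈ₛ-setoid : Setoid 0ℓ 0ℓ
≈ₛ-setoid = record
  { Carrier = Sub ; _≈_ = _≈ₛ_
  ; isEquivalence = record { refl = reflₛ ; sym = symₛ ; trans = transₛ } }

module ≈ₜ-Reasoning = SetoidReasoning ≈ₜ-setoid
module ≈ₛ-Reasoning = SetoidReasoning ≈ₛ-setoid

↑^-suc : ∀ k → ↑^ (suc k) ≈ₛ ↑^ k ∘ ↑
↑^-suc zero    = transₛ idR (symₛ idL)
↑^-suc (suc k) = transₛ (cong∘ reflₛ (↑^-suc k)) (symₛ assoc)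

↑^-suc-∘-ext : ∀ k {M f s} → ↑^ (suc k) ∘ (M ^ f · s) ≈ₛ ↑^ k ∘ s
↑^-suc-∘-ext k {M} {f} {s} = begin
  ↑^ (suc k) ∘ (M ^ f · s)   ≈⟨ cong∘ (↑^-suc k) reflₛ ⟩
  (↑^ k ∘ ↑) ∘ (M ^ f · s)   ≈⟨ assoc ⟩
  ↑^ k ∘ (↑ ∘ (M ^ f · s))   ≈⟨ cong∘ reflₛ shiftExt ⟩
  ↑^ k ∘ s                   ∎
  where open ≈ₛ-Reasoning

var-suc-[·] : ∀ k {g M f s} → var (suc (suc k)) g [ M ^ f · s ] ≈ₜ var (suc k) g [ s ]
var-suc-[·] k {g} {M} {f} {s} = begin
  var (suc (suc k)) g [ M ^ f · s ]      ≈⟨ cong[] varsuc reflₛ ⟩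
  var 1 g [ ↑^ (suc k) ] [ M ^ f · s ]   ≈⟨ clos ⟩
  var 1 g [ ↑^ (suc k) ∘ (M ^ f · s) ]   ≈⟨ cong[] reflₜ (↑^-suc-∘-ext k) ⟩
  var 1 g [ ↑^ k ∘ s ]                   ≈⟨ symₜ clos ⟩
  var 1 g [ ↑^ k ] [ s ]                 ≈⟨ cong[] (symₜ varsuc) reflₛ ⟩
  var (suc k) g [ s ]                    ∎
  where open ≈ₜ-Reasoning

↑^-∘-build : ∀ es n → ↑^ (length es) ∘ build es n ≈ₛ ↑^ n
↑^-∘-build []       n = idL
↑^-∘-build (_ ∷ es) n = transₛ (↑^-suc-∘-ext (length es)) (↑^-∘-build es n)

var-cong : ∀ {i i' g} → i ≡ i' → var i g ≈ₜ var i' g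
var-cong refl = reflₜ

idSub-var-from : ∀ {u Δ k B} j n → Δ ∋ suc k ∶ B →
                 var (suc k) (midFlag (u (suc k))) [ build (idEntries (pairs u Δ) j) n ]
                   ≈ₜ var (k + j) (srcFlag (u (suc k)))
idSub-var-from j n here = beta1
idSub-var-from {u} {k = suc k} j n (there ni) =
  transₜ (var-suc-[·] k) (transₜ (idSub-var-from {λ i → u (suc i)} (suc j) n ni) (var-cong (+-suc k j)))

idSub-var : ∀ {u Δ a B w} n → Δ ∋ a ∶ B → u a ≡ w →
            var a (midFlag w) [ build (idEntries (pairs u Δ) 1) n ] ≈ₜ var a (srcFlag w)
idSub-var {a = suc k} n ni refl = transₜ (idSub-var-from 1 n ni) (var-cong (+-comm k 1))

factor-≈ : ∀ {Δ u es Γ' n n'} → n' ≡ length Δ → Tracks u es Γ' → Pointwise (Δ ⊩ₑ_∶_) es Γ' →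
           build es n ≈ₛ build (relabel es Γ') n' ∘ build (idEntries (pairs u Δ) 1) n
factor-≈ {Δ} {u} {n = n} refl [] [] =
  subst (λ i → ↑^ n ≈ₛ ↑^ i ∘ build (idEntries (pairs u Δ) 1) n)
        (trans (length-idEntries (pairs u Δ) 1) (length-pairs u Δ))
        (symₛ (↑^-∘-build (idEntries (pairs u Δ) 1) n))
factor-≈ {Δ} {u} {e ∷ es} {(B , m) ∷ Γ'} {n} len (t ∷ ts) (ext ∷ exts) =
  transₛ (cong· (symₜ head) (factor-≈ len ts exts)) (symₛ extComp)
  where
  head : var (idx e) (midFlag (useOf e m)) [ build (idEntries (pairs u Δ) 1) n ] ≈ₜ var (idx e) (vflag e)
  head = subst (λ g → var (idx e) (midFlag (useOf e m)) [ build (idEntries (pairs u Δ) 1) n ] ≈ₜ var (idx e) g)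
               (srcFlag-useOf e m) (idSub-var n (⊩ₑ-∋ ext) t)

theorem8 : (Γ Γ' : Ctx) (s : Sub) → IsLCPatternSub Γ s Γ' →
    Σ Sub λ s' → Σ Sub λ t → Σ Ctx λ Γ'' →
      IsPatternSub Γ'' s' Γ' × IsLCIdSub t × (Γ ⊢ₛ t ∶ Γ'') × (s ≈ₛ s' ∘ t)
theorem8 Γ Γ' _ (es , refl , distinct , ⊢s) =
  build es' (length Γ'') , build (idEntries fs 1) (length fs) , Γ'' ,
  (es' , refl , _⊩_∶_.distinct ⊩s' , relabel-unchanging es Γ' , ⊩⇒⊢ refl ⊩s') ,
  (fs , refl , pairs-≼ u fits) ,
  ⊩⇒⊢ (sym (length-pairs u Γ)) (idSub-⊩ u fits) ,
  subst (λ i → build es (length Γ) ≈ₛ build es' (length Γ'') ∘ build (idEntries fs 1) i)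
        (sym (length-pairs u Γ))
        (factor-≈ (length-tys (middle-tys u Γ)) (useAt-tracks distinct exts) exts)
  where
  ⊩s : Γ ⊩ es ∶ Γ'
  ⊩s = ⊢⇒⊩ refl distinct ⊢s
  exts : Pointwise (Γ ⊩ₑ_∶_) es Γ'
  exts = extensions ⊩s
  u : ℕ → Use
  u = useAt es Γ'
  fits : Fits u Γ
  fits = ⊩-Fits ⊩s
  Γ'' : Ctx
  Γ'' = middle u Γ
  fs : List (Flag × Flag)
  fs = pairs u Γ
  es' : List Entry
  es' = relabel es Γ'
  ⊩s' : Γ'' ⊩ es' ∶ Γ'
  ⊩s' = relabel-⊩ ⊩s
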